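{- The Boolean query EVEN is not definable in the logic $\mathcal L$: there is no sentence $\phi$ of $\mathcal L[\{E\}]$ such that for every finite graph $\mathcal G$ with vertex set $V$, $\mathcal G\models\phi$ iff $|V|$ is even.
   Context: Graphs are finite structures over the signature $\{E\}$ with $E$ binary. $\log(n)=\lceil\log_2 n\rceil$, $\log^k(n)=(\log(n))^k$. $\mathscr L^\omega_{\infty\omega}=\bigcup_s\mathscr L^s_{\infty\omega}$, where $\mathscr L^s_{\infty\omega}$ is infinitary logic (first-order logic with arbitrary infinite conjunctions and disjunctions) with at most $s$ element variables. For $k>0$, $\exists^{\log^k}$ is the second-order quantifier with $\mathscr A\models\exists^{\log^k}X\phi$ iff there is $S\subseteq A^{\mathrm{arity}(X)}$ with $|S|\le\log^k(|A|)$ such that $\mathscr A\models\phi[X/S]$, and $\forall^{\log^k}X:=\neg\exists^{\log^k}X\neg$. The logic $\mathcal L$ is the smallest class of formulas containing all $\mathscr L^\omega_{\infty\omega}$-formulas and closed under forming $\exists^{\log^k}X\phi$ and $\forall^{\log^k}X\phi$ (for $k>0$ and $X$ a relation variable), $\psi\wedge\chi$ and $\psi\vee\chi$. -}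

module Defs where

open import Data.Nat using (ℕ; zero; suc; _≤_; _^_)
open import Data.Nat.Logarithm using (⌈log₂_⌉)
open import Data.Nat.Divisibility using (_∣_)
open import Data.Fin using (Fin; _≟_)
open import Data.Bool using (Bool; true; if_then_else_)
open import Data.Vec using (Vec; map)
import Data.Vec.Membership.Propositional as VecMem
open import Data.List using (List; _∷_; length)
open import Data.List as L using ()
open import Data.List.Membership.Propositional using (_∈_)
open import Data.List.Relation.Unary.Any using (here; there)
open import Data.List.Relation.Unary.All using (All; lookup; _∷_; [])
open import Data.Product using (Σ; _×_)
open import Data.Sum using (_⊎_)
open import Relation.Nullary using (¬_; does)
open import Relation.Binary.PropositionalEquality using (_≡_; _≢_; refl)

-- Finite graphs = finite {E}-structures (E an arbitrary binary relation).
-- The universe is Fin (suc pred), i.e. a nonempty finite set of size n.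

record Graph : Set where
  field
    pred : ℕ
    E    : Fin (suc pred) → Fin (suc pred) → Bool

  n : ℕ
  n = suc pred

  V : Set
  V = Fin n

open Graph public

-- log(n) = ⌈log₂ n⌉ ,  log^k(n) = (log n)^k
logPow : ℕ → ℕ → ℕ
logPow k m = ⌈log₂ m ⌉ ^ k

-- Relation-variable contexts: a list of arities.  An interpretation assigns
-- to a relation variable of arity r a finite set S ⊆ V^r, given as a list
-- of r-tuples (S = set of its entries).

RCtx : Set
RCtx = List ℕ

Env : Graph → RCtx → Set
Env G Γ = All (λ r → List (Vec (V G) r)) Γ

-- Infinitary logic L^s_{∞ω} with s element variables x_0..x_{s-1},
-- over {E} plus the relation variables of Γ (as free second-order atoms).

data Fml (Γ : RCtx) (s : ℕ) : Set₁ where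
  eqA   : Fin s → Fin s → Fml Γ s
  edgeA : Fin s → Fin s → Fml Γ s
  relA  : ∀ {r} → r ∈ Γ → Vec (Fin s) r → Fml Γ s
  neg   : Fml Γ s → Fml Γ s
  conj  : (I : Set) → (I → Fml Γ s) → Fml Γ s
  disj  : (I : Set) → (I → Fml Γ s) → Fml Γ s
  ex    : Fin s → Fml Γ s → Fml Γ s
  all   : Fin s → Fml Γ s → Fml Γ s

data Free {Γ : RCtx} {s : ℕ} (i : Fin s) : Fml Γ s → Set₁ where
  eqL   : ∀ {j} → Free i (eqA i j)
  eqR   : ∀ {j} → Free i (eqA j i)
  edgeL : ∀ {j} → Free i (edgeA i j)
  edgeR : ∀ {j} → Free i (edgeA j i)
  relF  : ∀ {r} {X : r ∈ Γ} {xs : Vec (Fin s) r} → i VecMem.∈ xs → Free i (relA X xs)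
  negF  : ∀ {φ} → Free i φ → Free i (neg φ)
  conjF : ∀ {I f} (ι : I) → Free i (f ι) → Free i (conj I f)
  disjF : ∀ {I f} (ι : I) → Free i (f ι) → Free i (disj I f)
  exF   : ∀ {j φ} → i ≢ j → Free i φ → Free i (ex j φ)
  allF  : ∀ {j φ} → i ≢ j → Free i φ → Free i (all j φ)

Closed : ∀ {Γ s} → Fml Γ s → Set₁
Closed {s = s} φ = (i : Fin s) → ¬ Free i φ

_[_↦_] : ∀ {A : Set} {s} → (Fin s → A) → Fin s → A → (Fin s → A)
(β [ i ↦ a ]) j = if does (j ≟ i) then a else β j

Sat : ∀ {Γ s} (G : Graph) → Env G Γ → (Fin s → V G) → Fml Γ s → Set
Sat G ρ β (eqA i j)   = β i ≡ β j
Sat G ρ β (edgeA i j) = E G (β i) (β j) ≡ true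
Sat G ρ β (relA X xs) = map β xs ∈ lookup ρ X
Sat G ρ β (neg φ)     = ¬ Sat G ρ β φ
Sat G ρ β (conj I f)  = (ι : I) → Sat G ρ β (f ι)
Sat G ρ β (disj I f)  = Σ I (λ ι → Sat G ρ β (f ι))
Sat G ρ β (ex i φ)    = Σ (V G) (λ a → Sat G ρ (β [ i ↦ a ]) φ)
Sat G ρ β (all i φ)   = (a : V G) → Sat G ρ (β [ i ↦ a ]) φ

-- The logic 𝓛: closed L^ω_{∞ω} formulas (any number s of variables),
-- closed under ∃^{log^k} X, ∀^{log^k} X (k > 0, X of any arity r), ∧, ∨.

data LForm (Γ : RCtx) : Set₁ where
  base   : (s : ℕ) (φ : Fml Γ s) → Closed φ → LForm Γ
  exLog  : (k : ℕ) → 1 ≤ k → (r : ℕ) → LForm (r ∷ Γ) → LForm Γ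
  allLog : (k : ℕ) → 1 ≤ k → (r : ℕ) → LForm (r ∷ Γ) → LForm Γ
  andL   : LForm Γ → LForm Γ → LForm Γ
  orL    : LForm Γ → LForm Γ → LForm Γ

-- constant assignment (element-closed formulas do not depend on it)
β₀ : ∀ {s} (G : Graph) → Fin s → V G
β₀ G _ = Fin.zero
  where import Data.Fin as Fin

SatL : ∀ {Γ} (G : Graph) → Env G Γ → LForm Γ → Set
SatL G ρ (base s φ _)     = Sat G ρ (β₀ G) φ
SatL G ρ (exLog k _ r ψ)  =
  Σ (List (Vec (V G) r)) λ S → (length S ≤ logPow k (n G)) × SatL G (S ∷ ρ) ψ
SatL G ρ (allLog k _ r ψ) =
  ¬ Σ (List (Vec (V G) r)) λ S → (length S ≤ logPow k (n G)) × ¬ SatL G (S ∷ ρ) ψ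
SatL G ρ (andL ψ χ)       = SatL G ρ ψ × SatL G ρ χ
SatL G ρ (orL ψ χ)        = SatL G ρ ψ ⊎ SatL G ρ χ

Sentence : Set₁
Sentence = LForm L.[]

_⊨_ : Graph → Sentence → Set
G ⊨ φ = SatL G [] φ

-- The edgeless graphs on 1 + 2^(t+1) and 2 + 2^(t+1) vertices have the same ⌈log₂ n⌉ = t + 2, and only the second
-- has even size, so it suffices that no sentence of 𝓛 distinguishes them once t is large. Duplicator keeps a partial
-- bijection π between the two vertex sets: a set chosen by a quantifier ∃^{log^k} X is answered by extending π to all
-- entries of its (at most (t + 2)^k) tuples and taking the image, and a first-order move is answered so that the
-- pebbled pairs together with π still form a partial bijection, which preserves all atoms as there are no edges.
-- Each answer needs a vertex outside the finitely many already matched ones; their number is polynomial in t,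
-- hence below 2^(t+1) for large t.
module Submission where

open import Defs
open import Data.Bool using (false)
open import Data.Nat hiding (_≟_)
open import Data.Nat.Properties hiding (_≟_)
open import Data.Nat.Logarithm using (⌈log₂_⌉; ⌈log₂⌈n/2⌉⌉≡⌈log₂n⌉∸1; ⌈log₂2*n⌉≡1+⌈log₂n⌉)
open import Data.Nat.Divisibility using (_∣_; _∤_; m∣m*n; quotient; m∣n⇒n≡m*quotient)
open import Data.Nat.Tactic.RingSolver using (solve-∀)
open import Data.Fin using (Fin; zero; _≟_)
open import Data.Fin.Properties as Fin using (pigeonhole; ¬∀⟶∃¬)
open import Data.List using (List; []; _∷_; length; lookup; tabulate; _++_)
open import Data.List.Properties using (length-++; length-tabulate)
open import Data.List.Membership.Propositional using (_∈_; _∉_)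
open import Data.List.Membership.Propositional.Properties using (∈-tabulate⁺; ∈-++⁺ˡ; ∈-++⁺ʳ)
open import Data.List.Relation.Unary.Any using (here; there; index; any?)
open import Data.List.Relation.Unary.Any.Properties using (lookup-index)
open import Data.List.Relation.Unary.All as All using (All)
open import Data.List.Relation.Binary.Pointwise as Pointwiseᴸ using ([]; _∷_; Pointwise-length)
open import Data.Vec as Vec using (Vec; []; _∷_)
open import Data.Vec.Relation.Binary.Pointwise.Inductive as Pointwiseⱽ using ([]; _∷_)
open import Data.Product as Product using (Σ; ∃; Σ-syntax; _×_; _,_)
open import Data.Sum as Sum using (_⊎_; inj₁; inj₂)
open import Data.Empty using (⊥)
open import Function using (id; _∘_)
open import Function.Bundles using (_⇔_; Equivalence)
open import Relation.Nullary using (¬_; Dec; yes; no; contradiction)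
open import Relation.Nullary.Decidable using (map′)
open import Relation.Binary.PropositionalEquality

private
  variable
    N N₁ N₂ m m′ r : ℕ

n<2^n : ∀ n → n < 2 ^ n
n<2^n zero    = z<s
n<2^n (suc n) = +-mono-≤ (m^n>0 2 n) (≤-trans (n<2^n n) (m≤m+n (2 ^ n) 0))

⌊n+n/2⌋≡n : ∀ n → ⌊ n + n /2⌋ ≡ n
⌊n+n/2⌋≡n zero    = refl
⌊n+n/2⌋≡n (suc n) = trans (cong (λ m → ⌊ suc m /2⌋) (+-suc n n)) (cong suc (⌊n+n/2⌋≡n n))

⌈log₂[1+2^n]⌉≡1+n : ∀ n → ⌈log₂ (1 + 2 ^ n) ⌉ ≡ 1 + n
⌈log₂[1+2^n]⌉≡1+n zero    = refl
⌈log₂[1+2^n]⌉≡1+n (suc n) = m∸1≡1+n⇒m≡2+n (begin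
  ⌈log₂ (1 + 2 ^ suc n) ⌉ ∸ 1   ≡⟨ ⌈log₂⌈n/2⌉⌉≡⌈log₂n⌉∸1 (1 + 2 ^ suc n) ⟨
  ⌈log₂ ⌈ 1 + 2 ^ suc n /2⌉ ⌉   ≡⟨ cong (λ m → ⌈log₂ (1 + m) ⌉) ⌊2^[1+n]/2⌋≡2^n ⟩
  ⌈log₂ (1 + 2 ^ n) ⌉           ≡⟨ ⌈log₂[1+2^n]⌉≡1+n n ⟩
  1 + n                          ∎)
  where
  open ≡-Reasoning
  ⌊2^[1+n]/2⌋≡2^n : ⌊ 2 ^ suc n /2⌋ ≡ 2 ^ n
  ⌊2^[1+n]/2⌋≡2^n = trans (cong (λ m → ⌊ 2 ^ n + m /2⌋) (+-identityʳ (2 ^ n))) (⌊n+n/2⌋≡n (2 ^ n))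
  m∸1≡1+n⇒m≡2+n : ∀ {m} → m ∸ 1 ≡ 1 + n → m ≡ 2 + n
  m∸1≡1+n⇒m≡2+n {suc m} = cong suc

2+2^[1+n]≡2*[1+2^n] : ∀ n → 2 + 2 ^ suc n ≡ 2 * (1 + 2 ^ n)
2+2^[1+n]≡2*[1+2^n] n = sym (*-distribˡ-+ 2 1 (2 ^ n))

⌈log₂[2+2^[1+n]]⌉≡2+n : ∀ n → ⌈log₂ (2 + 2 ^ suc n) ⌉ ≡ 2 + n
⌈log₂[2+2^[1+n]]⌉≡2+n n = begin
  ⌈log₂ (2 + 2 ^ suc n) ⌉     ≡⟨ cong ⌈log₂_⌉ (2+2^[1+n]≡2*[1+2^n] n) ⟩
  ⌈log₂ (2 * (1 + 2 ^ n)) ⌉   ≡⟨ ⌈log₂2*n⌉≡1+⌈log₂n⌉ (1 + 2 ^ n) ⟩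
  1 + ⌈log₂ (1 + 2 ^ n) ⌉     ≡⟨ cong suc (⌈log₂[1+2^n]⌉≡1+n n) ⟩
  2 + n                        ∎
  where open ≡-Reasoning

m+2^n≤2^[m+n] : ∀ m n → m + 2 ^ n ≤ 2 ^ (m + n)
m+2^n≤2^[m+n] zero    n = ≤-refl
m+2^n≤2^[m+n] (suc m) n = +-mono-≤ (m^n>0 2 (m + n)) (≤-trans (m+2^n≤2^[m+n] m n) (m≤m+n _ 0))

linear<exponential : ∀ a c → ∃ λ u → (a + u) * c < 2 ^ u
linear<exponential a c = v + v , (begin-strict
  (a + (v + v)) * c        ≤⟨ *-monoˡ-≤ c (+-monoˡ-≤ (v + v) (m≤m+n a (3 * c))) ⟩
  (v + (v + v)) * c        ≡⟨ 3v*c≡v*3c v c ⟩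
  v * (3 * c)              ≤⟨ *-monoʳ-≤ v (m≤n+m (3 * c) a) ⟩
  v * v                    <⟨ *-mono-< (n<1+n v) (n<1+n v) ⟩
  suc v * suc v            ≤⟨ *-mono-≤ (n<2^n v) (n<2^n v) ⟩
  2 ^ v * 2 ^ v            ≡⟨ ^-distribˡ-+-* 2 v v ⟨
  2 ^ (v + v)              ∎)
  where
  open ≤-Reasoning
  v : ℕ
  v = a + 3 * c
  3v*c≡v*3c : ∀ v c → (v + (v + v)) * c ≡ v * (3 * c)
  3v*c≡v*3c = solve-∀

polynomial<exponential : ∀ a c → ∃ λ t → (a + t) ^ c < 2 ^ t
polynomial<exponential a c with linear<exponential a c
... | u , lin = 2 ^ u , (begin-strict
  (a + 2 ^ u) ^ c          ≤⟨ ^-monoˡ-≤ c (m+2^n≤2^[m+n] a u) ⟩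
  (2 ^ (a + u)) ^ c        ≡⟨ ^-*-assoc 2 (a + u) c ⟩
  2 ^ ((a + u) * c)        <⟨ ^-monoʳ-< 2 (s≤s (s≤s z≤n)) lin ⟩
  2 ^ 2 ^ u                ∎)
  where open ≤-Reasoning

2∤1+2*n : ∀ n → 2 ∤ 1 + 2 * n
2∤1+2*n n 2∣ = even≢odd (quotient 2∣) n (sym (m∣n⇒n≡m*quotient 2∣))

fresh : (xs : List (Fin N)) → length xs < N → ∃ (_∉ xs)
fresh {N} xs |xs|<N = ¬∀⟶∃¬ N (_∈ xs) (λ b → any? (b ≟_) xs) not-all
  where
  not-all : ¬ (∀ b → b ∈ xs)
  not-all all∈ with pigeonhole |xs|<N (λ b → index (all∈ b))
  ... | i , j , i<j , same-index = Fin.<-irrefl i≡j i<j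
    where
    i≡j : i ≡ j
    i≡j = trans (lookup-index (all∈ i)) (trans (cong (lookup xs) same-index) (sym (lookup-index (all∈ j))))

-- The lists dom and rng bound the size of the bijection by m; this is what leaves room for fresh elements.
record PartialBijection (N₁ N₂ m : ℕ) : Set₁ where
  field
    related    : Fin N₁ → Fin N₂ → Set
    functional : ∀ {a b b′} → related a b → related a b′ → b ≡ b′
    injective  : ∀ {a a′ b} → related a b → related a′ b → a ≡ a′
    image?     : ∀ a → Dec (∃ λ b → related a b)
    preimage?  : ∀ b → Dec (∃ λ a → related a b)
    dom        : List (Fin N₁)
    rng        : List (Fin N₂)
    ∈-dom      : ∀ {a b} → related a b → a ∈ dom
    ∈-rng      : ∀ {a b} → related a b → b ∈ rng
    |dom|≤m    : length dom ≤ m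
    |rng|≤m    : length rng ≤ m

open PartialBijection

InDomain : PartialBijection N₁ N₂ m → Fin N₁ → Set
InDomain π a = ∃ λ b → related π a b

InRange : PartialBijection N₁ N₂ m → Fin N₂ → Set
InRange π b = ∃ λ a → related π a b

_⁻¹ : PartialBijection N₁ N₂ m → PartialBijection N₂ N₁ m
π ⁻¹ = record
  { related = λ b a → related π a b
  ; functional = injective π ; injective = functional π
  ; image? = preimage? π ; preimage? = image? π
  ; dom = rng π ; rng = dom π ; ∈-dom = ∈-rng π ; ∈-rng = ∈-dom π
  ; |dom|≤m = |rng|≤m π ; |rng|≤m = |dom|≤m π
  }

weaken : m ≤ m′ → PartialBijection N₁ N₂ m → PartialBijection N₁ N₂ m′
weaken m≤m′ π = record
  { related = related π
  ; functional = functional π ; injective = injective π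
  ; image? = image? π ; preimage? = preimage? π
  ; dom = dom π ; rng = rng π ; ∈-dom = ∈-dom π ; ∈-rng = ∈-rng π
  ; |dom|≤m = ≤-trans (|dom|≤m π) m≤m′ ; |rng|≤m = ≤-trans (|rng|≤m π) m≤m′
  }

empty : PartialBijection N₁ N₂ 0
empty = record
  { related = λ _ _ → ⊥
  ; functional = λ () ; injective = λ ()
  ; image? = λ _ → no λ () ; preimage? = λ _ → no λ ()
  ; dom = [] ; rng = [] ; ∈-dom = λ () ; ∈-rng = λ ()
  ; |dom|≤m = ≤-refl ; |rng|≤m = ≤-refl
  }

extend : (π : PartialBijection N₁ N₂ m) (a : Fin N₁) (b : Fin N₂) →
         ¬ InDomain π a → ¬ InRange π b → PartialBijection N₁ N₂ (suc m)
extend {N₁} {N₂} π a b a∉dom b∉rng = record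
  { related = related′
  ; functional = functional′ ; injective = injective′
  ; image? = image?′ ; preimage? = preimage?′
  ; dom = a ∷ dom π ; rng = b ∷ rng π ; ∈-dom = ∈-dom′ ; ∈-rng = ∈-rng′
  ; |dom|≤m = s≤s (|dom|≤m π) ; |rng|≤m = s≤s (|rng|≤m π)
  }
  where
  related′ : Fin N₁ → Fin N₂ → Set
  related′ a′ b′ = (a′ ≡ a × b′ ≡ b) ⊎ related π a′ b′

  functional′ : ∀ {a′ b′ b″} → related′ a′ b′ → related′ a′ b″ → b′ ≡ b″
  functional′ (inj₁ (_ , refl)) (inj₁ (_ , refl)) = refl
  functional′ (inj₁ (refl , _)) (inj₂ p)          = contradiction (_ , p) a∉dom
  functional′ (inj₂ p)          (inj₁ (refl , _)) = contradiction (_ , p) a∉dom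
  functional′ (inj₂ p)          (inj₂ q)          = functional π p q

  injective′ : ∀ {a′ a″ b′} → related′ a′ b′ → related′ a″ b′ → a′ ≡ a″
  injective′ (inj₁ (refl , _)) (inj₁ (refl , _)) = refl
  injective′ (inj₁ (_ , refl)) (inj₂ p)          = contradiction (_ , p) b∉rng
  injective′ (inj₂ p)          (inj₁ (_ , refl)) = contradiction (_ , p) b∉rng
  injective′ (inj₂ p)          (inj₂ q)          = injective π p q

  image?′ : ∀ a′ → Dec (∃ (related′ a′))
  image?′ a′ with a′ ≟ a
  ... | yes a′≡a = yes (b , inj₁ (a′≡a , refl))
  ... | no  a′≢a = map′ (λ (b′ , p) → b′ , inj₂ p) old (image? π a′)
    where
    old : ∃ (related′ a′) → InDomain π a′
    old (_ , inj₁ (a′≡a , _)) = contradiction a′≡a a′≢a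
    old (b′ , inj₂ p)         = b′ , p

  preimage?′ : ∀ b′ → Dec (∃ λ a′ → related′ a′ b′)
  preimage?′ b′ with b′ ≟ b
  ... | yes b′≡b = yes (a , inj₁ (refl , b′≡b))
  ... | no  b′≢b = map′ (λ (a′ , p) → a′ , inj₂ p) old (preimage? π b′)
    where
    old : ∃ (λ a′ → related′ a′ b′) → InRange π b′
    old (_ , inj₁ (_ , b′≡b)) = contradiction b′≡b b′≢b
    old (a′ , inj₂ p)         = a′ , p

  ∈-dom′ : ∀ {a′ b′} → related′ a′ b′ → a′ ∈ a ∷ dom π
  ∈-dom′ (inj₁ (a′≡a , _)) = here a′≡a
  ∈-dom′ (inj₂ p)          = there (∈-dom π p)

  ∈-rng′ : ∀ {a′ b′} → related′ a′ b′ → b′ ∈ b ∷ rng π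
  ∈-rng′ (inj₁ (_ , b′≡b)) = here b′≡b
  ∈-rng′ (inj₂ p)          = there (∈-rng π p)

-- Base formulas are evaluated at the constant assignment β₀ to vertex zero, so the zeros are matched from the start.
zero↦zero : ∀ {p q} → PartialBijection (suc p) (suc q) 1
zero↦zero = extend empty zero zero (λ ()) (λ ())

_⊑_ : PartialBijection N₁ N₂ m → PartialBijection N₁ N₂ m′ → Set
π ⊑ π′ = ∀ {a b} → related π a b → related π′ a b

TupleRel : {A B : Set} → (A → B → Set) → Vec A r → Vec B r → Set
TupleRel R = Pointwiseⱽ.Pointwise R

TuplesRel : {A B : Set} → (A → B → Set) → List (Vec A r) → List (Vec B r) → Set
TuplesRel R = Pointwiseᴸ.Pointwise (TupleRel R)

cover : (π : PartialBijection N₁ N₂ m) → m < N₂ → (a : Fin N₁) →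
        Σ[ π′ ∈ PartialBijection N₁ N₂ (suc m) ] π ⊑ π′ × InDomain π′ a
cover π m<N₂ a with image? π a
... | yes a∈dom = weaken (n≤1+n _) π , id , a∈dom
... | no  a∉dom with fresh (rng π) (≤-trans (s≤s (|rng|≤m π)) m<N₂)
...   | b , b∉rng = extend π a b a∉dom (λ (_ , p) → b∉rng (∈-rng π p)) , inj₂ , b , inj₁ (refl , refl)

coverTuple : (π : PartialBijection N₁ N₂ m) (v : Vec (Fin N₁) r) → r + m ≤ N₂ →
             Σ[ π′ ∈ PartialBijection N₁ N₂ (r + m) ] π ⊑ π′ × ∃ (TupleRel (related π′) v)
coverTuple π []      _      = π , id , [] , []
coverTuple π (a ∷ v) r+m<N₂ with coverTuple π v (<⇒≤ r+m<N₂)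
... | π₁ , π⊑π₁ , w , v∼w with cover π₁ r+m<N₂ a
...   | π₂ , π₁⊑π₂ , b , a∼b = π₂ , π₁⊑π₂ ∘ π⊑π₁ , b ∷ w , a∼b ∷ Pointwiseⱽ.map π₁⊑π₂ v∼w

coverTuples : (π : PartialBijection N₁ N₂ m) (S : List (Vec (Fin N₁) r)) → length S * r + m ≤ N₂ →
              Σ[ π′ ∈ PartialBijection N₁ N₂ (length S * r + m) ] π ⊑ π′ × ∃ (TuplesRel (related π′) S)
coverTuples π []      _     = π , id , [] , []
coverTuples {N₂ = N₂} {m = m} {r = r} π (v ∷ S) bound = cons (subst (_≤ N₂) (+-assoc r (length S * r) m) bound)
  where
  cons : r + (length S * r + m) ≤ N₂ →
         Σ[ π′ ∈ PartialBijection _ N₂ (length (v ∷ S) * r + m) ] π ⊑ π′ × ∃ (TuplesRel (related π′) (v ∷ S))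
  cons bound′ with coverTuples π S (≤-trans (m≤n+m _ r) bound′)
  ... | π₁ , π⊑π₁ , T , S∼T with coverTuple π₁ v bound′
  ...   | π₂ , π₁⊑π₂ , w , v∼w =
    weaken (≤-reflexive (sym (+-assoc r (length S * r) m))) π₂ ,
    π₁⊑π₂ ∘ π⊑π₁ , w ∷ T , v∼w ∷ Pointwiseᴸ.map (Pointwiseⱽ.map π₁⊑π₂) S∼T

record EnvRel {A B : Set} {Γ : RCtx} (R : A → B → Set)
              (ρ₁ : All (λ r → List (Vec A r)) Γ) (ρ₂ : All (λ r → List (Vec B r)) Γ) : Set where
  constructor envRel
  field
    lookupᴱ : ∀ {r} (X : r ∈ Γ) → TuplesRel R (All.lookup ρ₁ X) (All.lookup ρ₂ X)

open EnvRel

module _ {A B : Set} {R : A → B → Set} {Γ : RCtx}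
         {ρ₁ : All (λ r → List (Vec A r)) Γ} {ρ₂ : All (λ r → List (Vec B r)) Γ} where

  _∷ᴱ_ : {S₁ : List (Vec A r)} {S₂ : List (Vec B r)} →
         TuplesRel R S₁ S₂ → EnvRel R ρ₁ ρ₂ → EnvRel R (S₁ All.∷ ρ₁) (S₂ All.∷ ρ₂)
  S₁∼S₂ ∷ᴱ ρ₁∼ρ₂ = envRel λ where
    (here refl) → S₁∼S₂
    (there X)   → lookupᴱ ρ₁∼ρ₂ X

  EnvRel-map : {R′ : A → B → Set} → (∀ {a b} → R a b → R′ a b) → EnvRel R ρ₁ ρ₂ → EnvRel R′ ρ₁ ρ₂
  EnvRel-map R⇒R′ ρ₁∼ρ₂ = envRel λ X → Pointwiseᴸ.map (Pointwiseⱽ.map R⇒R′) (lookupᴱ ρ₁∼ρ₂ X)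

  EnvRel-sym : EnvRel R ρ₁ ρ₂ → EnvRel (λ b a → R a b) ρ₂ ρ₁
  EnvRel-sym ρ₁∼ρ₂ = envRel λ X → Pointwiseᴸ.symmetric (Pointwiseⱽ.sym id) (lookupᴱ ρ₁∼ρ₂ X)

Compatible : PartialBijection N₁ N₂ m → Fin N₁ → Fin N₂ → Set
Compatible π a b = related π a b ⊎ (¬ InDomain π a × ¬ InRange π b)

-- Pebble i joins β₁ i to β₂ i; together with π these pairs must form a partial bijection.
record Consistent {s} (π : PartialBijection N₁ N₂ m) (β₁ : Fin s → Fin N₁) (β₂ : Fin s → Fin N₂) : Set where
  field
    ≡⇒≡        : ∀ i j → β₁ i ≡ β₁ j → β₂ i ≡ β₂ j
    ≡⇐≡        : ∀ i j → β₂ i ≡ β₂ j → β₁ i ≡ β₁ j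
    compatible : ∀ i → Compatible π (β₁ i) (β₂ i)

open Consistent

module _ {s} {π : PartialBijection N₁ N₂ m} {β₁ : Fin s → Fin N₁} {β₂ : Fin s → Fin N₂} where

  Consistent-⁻¹ : Consistent π β₁ β₂ → Consistent (π ⁻¹) β₂ β₁
  Consistent-⁻¹ c = record
    { ≡⇒≡ = ≡⇐≡ c ; ≡⇐≡ = ≡⇒≡ c ; compatible = λ i → swap (compatible c i) }
    where
    swap : ∀ {a b} → Compatible π a b → Compatible (π ⁻¹) b a
    swap (inj₁ a∼b)              = inj₁ a∼b
    swap (inj₂ (a∉dom , b∉rng)) = inj₂ (b∉rng , a∉dom)

[↦]-preserves-≡ : ∀ {s} {A B : Set} {β₁ : Fin s → A} {β₂ : Fin s → B} {a b} →
                  (∀ j k → β₁ j ≡ β₁ k → β₂ j ≡ β₂ k) → (∀ k → β₁ k ≡ a → β₂ k ≡ b) →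
                  ∀ i j k → (β₁ [ i ↦ a ]) j ≡ (β₁ [ i ↦ a ]) k → (β₂ [ i ↦ b ]) j ≡ (β₂ [ i ↦ b ]) k
[↦]-preserves-≡ preserves preserves-a i j k eq with j ≟ i | k ≟ i
... | yes _ | yes _ = refl
... | yes _ | no  _ = sym (preserves-a k (sym eq))
... | no  _ | yes _ = preserves-a j eq
... | no  _ | no  _ = preserves j k eq

module _ {s} {π : PartialBijection N₁ N₂ m} {β₁ : Fin s → Fin N₁} {β₂ : Fin s → Fin N₂} where

  update : Consistent π β₁ β₂ → ∀ i {a b} →
           (∀ k → β₁ k ≡ a → β₂ k ≡ b) → (∀ k → β₂ k ≡ b → β₁ k ≡ a) → Compatible π a b →
           Consistent π (β₁ [ i ↦ a ]) (β₂ [ i ↦ b ])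
  update c i {a} {b} to from a≈b = record
    { ≡⇒≡ = [↦]-preserves-≡ (≡⇒≡ c) to i
    ; ≡⇐≡ = [↦]-preserves-≡ (≡⇐≡ c) from i
    ; compatible = compatible′
    }
    where
    compatible′ : ∀ j → Compatible π ((β₁ [ i ↦ a ]) j) ((β₂ [ i ↦ b ]) j)
    compatible′ j with j ≟ i
    ... | yes _ = a≈b
    ... | no  _ = compatible c j

  forth : s + m < N₂ → Consistent π β₁ β₂ → ∀ i a → ∃ λ b → Consistent π (β₁ [ i ↦ a ]) (β₂ [ i ↦ b ])
  forth s+m<N₂ c i a with Fin.any? (λ j → β₁ j ≟ a)
  ... | yes (j , β₁j≡a) =
    β₂ j , update c i (λ k β₁k≡a → ≡⇒≡ c k j (trans β₁k≡a (sym β₁j≡a)))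
                      (λ k β₂k≡β₂j → trans (≡⇐≡ c k j β₂k≡β₂j) β₁j≡a)
                      (subst (λ a → Compatible π a (β₂ j)) β₁j≡a (compatible c j))
  ... | no a∉β₁ with image? π a
  ...   | yes (b , a∼b) = b , update c i (λ k β₁k≡a → contradiction (k , β₁k≡a) a∉β₁) from (inj₁ a∼b)
    where
    from : ∀ k → β₂ k ≡ b → β₁ k ≡ a
    from k refl with compatible c k
    ... | inj₁ β₁k∼b       = injective π β₁k∼b a∼b
    ... | inj₂ (_ , b∉rng) = contradiction (a , a∼b) b∉rng
  ...   | no a∉dom with fresh (tabulate β₂ ++ rng π) |used|<N₂
    where
    |used|<N₂ : length (tabulate β₂ ++ rng π) < N₂
    |used|<N₂ = begin-strict
      length (tabulate β₂ ++ rng π)          ≡⟨ length-++ (tabulate β₂) ⟩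
      length (tabulate β₂) + length (rng π)  ≡⟨ cong (_+ length (rng π)) (length-tabulate β₂) ⟩
      s + length (rng π)                     ≤⟨ +-monoʳ-≤ s (|rng|≤m π) ⟩
      s + m                                  <⟨ s+m<N₂ ⟩
      N₂                                     ∎
      where open ≤-Reasoning
  ...     | b , b∉used = b , update c i (λ k β₁k≡a → contradiction (k , β₁k≡a) a∉β₁) from
                 (inj₂ (a∉dom , λ (_ , a′∼b) → b∉used (∈-++⁺ʳ (tabulate β₂) (∈-rng π a′∼b))))
    where
    from : ∀ k → β₂ k ≡ b → β₁ k ≡ a
    from k refl = contradiction (∈-++⁺ˡ (∈-tabulate⁺ k)) b∉used

back : ∀ {s} {π : PartialBijection N₁ N₂ m} {β₁ : Fin s → Fin N₁} {β₂ : Fin s → Fin N₂} →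
       s + m < N₁ → Consistent π β₁ β₂ → ∀ i b → ∃ λ a → Consistent π (β₁ [ i ↦ a ]) (β₂ [ i ↦ b ])
back s+m<N₁ c i b with forth s+m<N₁ (Consistent-⁻¹ c) i b
... | a , c′ = a , Consistent-⁻¹ c′

module _ {s} {π : PartialBijection N₁ N₂ m} {β₁ : Fin s → Fin N₁} {β₂ : Fin s → Fin N₂}
         (c : Consistent π β₁ β₂) where

  image-of-map : (xs : Vec (Fin s) r) {ys : Vec (Fin N₂) r} →
                 TupleRel (related π) (Vec.map β₁ xs) ys → ys ≡ Vec.map β₂ xs
  image-of-map []       []              = refl
  image-of-map (x ∷ xs) (β₁x∼y ∷ rest) with compatible c x
  ... | inj₁ β₁x∼β₂x        = cong₂ _∷_ (functional π β₁x∼y β₁x∼β₂x) (image-of-map xs rest)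
  ... | inj₂ (β₁x∉dom , _) = contradiction (_ , β₁x∼y) β₁x∉dom

  map-∈-transfer : (xs : Vec (Fin s) r) {T₁ : List (Vec (Fin N₁) r)} {T₂ : List (Vec (Fin N₂) r)} →
                   TuplesRel (related π) T₁ T₂ → Vec.map β₁ xs ∈ T₁ → Vec.map β₂ xs ∈ T₂
  map-∈-transfer xs (t₁∼t₂ ∷ _)  (here refl) = here (sym (image-of-map xs t₁∼t₂))
  map-∈-transfer xs (_ ∷ T₁∼T₂) (there x∈T₁) = there (map-∈-transfer xs T₁∼T₂ x∈T₁)

constant-consistent : ∀ {s} {π : PartialBijection N₁ N₂ m} {a b} →
                      related π a b → Consistent {s = s} π (λ _ → a) (λ _ → b)
constant-consistent a∼b = record { ≡⇒≡ = λ _ _ _ → refl ; ≡⇐≡ = λ _ _ _ → refl ; compatible = λ _ → inj₁ a∼b }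

edgeless : ℕ → Graph
edgeless p = record { pred = p ; E = λ _ _ → false }

Sat-transfer : ∀ {p q s Γ} {ρ₁ : Env (edgeless p) Γ} {ρ₂ : Env (edgeless q) Γ}
               (π : PartialBijection (suc p) (suc q) m) → s + m < suc p → s + m < suc q →
               EnvRel (related π) ρ₁ ρ₂ → (φ : Fml Γ s) {β₁ : Fin s → Fin (suc p)} {β₂ : Fin s → Fin (suc q)} →
               Consistent π β₁ β₂ → Sat (edgeless p) ρ₁ β₁ φ → Sat (edgeless q) ρ₂ β₂ φ
Sat-transfer π b₁ b₂ ρ₁∼ρ₂ (eqA i j)   c β₁i≡β₁j    = ≡⇒≡ c i j β₁i≡β₁j
Sat-transfer π b₁ b₂ ρ₁∼ρ₂ (edgeA i j) c ()
Sat-transfer π b₁ b₂ ρ₁∼ρ₂ (relA X xs) c xs∈X       = map-∈-transfer c xs (lookupᴱ ρ₁∼ρ₂ X) xs∈X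
Sat-transfer π b₁ b₂ ρ₁∼ρ₂ (neg φ)     c ¬φ₁ φ₂     =
  ¬φ₁ (Sat-transfer (π ⁻¹) b₂ b₁ (EnvRel-sym ρ₁∼ρ₂) φ (Consistent-⁻¹ c) φ₂)
Sat-transfer π b₁ b₂ ρ₁∼ρ₂ (conj I φ)  c all-φ ι    = Sat-transfer π b₁ b₂ ρ₁∼ρ₂ (φ ι) c (all-φ ι)
Sat-transfer π b₁ b₂ ρ₁∼ρ₂ (disj I φ)  c (ι , φι)   = ι , Sat-transfer π b₁ b₂ ρ₁∼ρ₂ (φ ι) c φι
Sat-transfer π b₁ b₂ ρ₁∼ρ₂ (ex i φ)    c (a , φa) with forth b₂ c i a
... | b , c′ = b , Sat-transfer π b₁ b₂ ρ₁∼ρ₂ φ c′ φa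
Sat-transfer π b₁ b₂ ρ₁∼ρ₂ (all i φ)   c all-φ b with back b₁ c i b
... | a , c′ = Sat-transfer π b₁ b₂ ρ₁∼ρ₂ φ c′ (all-φ a)

-- Bounds the number of vertex pairs a play of the pebble game on ψ ever matches, when ⌈log₂ n⌉ = ℓ.
width : ∀ {Γ} → ℕ → LForm Γ → ℕ
width ℓ (base s _ _)     = s
width ℓ (exLog k _ r ψ)  = width ℓ ψ + ℓ ^ k * r
width ℓ (allLog k _ r ψ) = width ℓ ψ + ℓ ^ k * r
width ℓ (andL ψ χ)       = width ℓ ψ + width ℓ χ
width ℓ (orL ψ χ)        = width ℓ ψ + width ℓ χ

module _ (w : ℕ) {x y r m N : ℕ} (x≤y : x ≤ y) (budget : (w + y * r) + m < N) where

  budget-after-cover : w + (x * r + m) < N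
  budget-after-cover = begin-strict
    w + (x * r + m)   ≤⟨ +-monoʳ-≤ w (+-monoˡ-≤ m (*-monoˡ-≤ r x≤y)) ⟩
    w + (y * r + m)   ≡⟨ +-assoc w (y * r) m ⟨
    (w + y * r) + m   <⟨ budget ⟩
    N                 ∎
    where open ≤-Reasoning

  room-for-cover : x * r + m ≤ N
  room-for-cover = ≤-trans (m≤n+m _ w) (<⇒≤ budget-after-cover)

budget-left : ∀ w₁ w₂ {m N} → (w₁ + w₂) + m < N → w₁ + m < N
budget-left w₁ w₂ {m} = ≤-<-trans (+-monoˡ-≤ m (m≤m+n w₁ w₂))

budget-right : ∀ w₁ w₂ {m N} → (w₁ + w₂) + m < N → w₂ + m < N
budget-right w₁ w₂ {m} = ≤-<-trans (+-monoˡ-≤ m (m≤n+m w₂ w₁))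

module _ {p q : ℕ} (logs : ⌈log₂ (suc p) ⌉ ≡ ⌈log₂ (suc q) ⌉) where

  private
    ℓ : ℕ
    ℓ = ⌈log₂ (suc p) ⌉

  log-bound→ : ∀ {x} k → x ≤ ⌈log₂ (suc p) ⌉ ^ k → x ≤ ⌈log₂ (suc q) ⌉ ^ k
  log-bound→ {x} k = subst (λ ℓ → x ≤ ℓ ^ k) logs

  log-bound← : ∀ {x} k → x ≤ ⌈log₂ (suc q) ⌉ ^ k → x ≤ ⌈log₂ (suc p) ⌉ ^ k
  log-bound← {x} k = subst (λ ℓ → x ≤ ℓ ^ k) (sym logs)

  SatL-transfer : ∀ {Γ} {ρ₁ : Env (edgeless p) Γ} {ρ₂ : Env (edgeless q) Γ}
                  (ψ : LForm Γ) (π : PartialBijection (suc p) (suc q) m) → related π zero zero →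
                  width ℓ ψ + m < suc p → width ℓ ψ + m < suc q →
                  EnvRel (related π) ρ₁ ρ₂ → SatL (edgeless p) ρ₁ ψ → SatL (edgeless q) ρ₂ ψ
  SatL-transfer (base s φ _) π 0∼0 b₁ b₂ ρ₁∼ρ₂ = Sat-transfer π b₁ b₂ ρ₁∼ρ₂ φ (constant-consistent 0∼0)
  SatL-transfer (exLog k _ r ψ) π 0∼0 b₁ b₂ ρ₁∼ρ₂ (S₁ , |S₁|≤ , ψ₁)
    with coverTuples π S₁ (room-for-cover (width ℓ ψ) |S₁|≤ b₂)
  ... | π′ , π⊑π′ , S₂ , S₁∼S₂ =
    S₂ , log-bound→ k (subst (_≤ _) (Pointwise-length S₁∼S₂) |S₁|≤) ,
    SatL-transfer ψ π′ (π⊑π′ 0∼0) (budget′ b₁) (budget′ b₂) (S₁∼S₂ ∷ᴱ EnvRel-map π⊑π′ ρ₁∼ρ₂) ψ₁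
    where
    budget′ : ∀ {N} → width ℓ ψ + ℓ ^ k * r + m < N → width ℓ ψ + (length S₁ * r + m) < N
    budget′ = budget-after-cover (width ℓ ψ) |S₁|≤
  SatL-transfer (allLog k _ r ψ) π 0∼0 b₁ b₂ ρ₁∼ρ₂ no-S₁ (S₂ , |S₂|≤ , ¬ψ₂)
    with log-bound← k |S₂|≤
  ... | |S₂|≤′ with coverTuples (π ⁻¹) S₂ (room-for-cover (width ℓ ψ) |S₂|≤′ b₁)
  ...   | π′ , π⁻¹⊑π′ , S₁ , S₂∼S₁ =
    no-S₁ (S₁ , subst (_≤ _) (Pointwise-length S₂∼S₁) |S₂|≤′ , λ ψ₁ → ¬ψ₂
      (SatL-transfer ψ (π′ ⁻¹) (π⁻¹⊑π′ 0∼0) (budget′ b₁) (budget′ b₂)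
                     (EnvRel-sym (S₂∼S₁ ∷ᴱ EnvRel-map π⁻¹⊑π′ (EnvRel-sym ρ₁∼ρ₂))) ψ₁))
    where
    budget′ : ∀ {N} → width ℓ ψ + ℓ ^ k * r + m < N → width ℓ ψ + (length S₂ * r + m) < N
    budget′ = budget-after-cover (width ℓ ψ) |S₂|≤′
  SatL-transfer (andL ψ χ) π 0∼0 b₁ b₂ ρ₁∼ρ₂ =
    Product.map (SatL-transfer ψ π 0∼0 (budget-left wψ wχ b₁) (budget-left wψ wχ b₂) ρ₁∼ρ₂)
                (SatL-transfer χ π 0∼0 (budget-right wψ wχ b₁) (budget-right wψ wχ b₂) ρ₁∼ρ₂)
    where
    wψ wχ : ℕ
    wψ = width ℓ ψ
    wχ = width ℓ χ
  SatL-transfer (orL ψ χ) π 0∼0 b₁ b₂ ρ₁∼ρ₂ =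
    Sum.map (SatL-transfer ψ π 0∼0 (budget-left wψ wχ b₁) (budget-left wψ wχ b₂) ρ₁∼ρ₂)
            (SatL-transfer χ π 0∼0 (budget-right wψ wχ b₁) (budget-right wψ wχ b₂) ρ₁∼ρ₂)
    where
    wψ wχ : ℕ
    wψ = width ℓ ψ
    wχ = width ℓ χ

PolynomiallyBounded : (ℕ → ℕ) → Set
PolynomiallyBounded f = ∃ λ c → ∀ ℓ → f ℓ ≤ (2 + ℓ) ^ c

n≤[2+m]^n : ∀ m n → n ≤ (2 + m) ^ n
n≤[2+m]^n m n = ≤-trans (<⇒≤ (n<2^n n)) (^-monoˡ-≤ n (m≤m+n 2 m))

const-polynomial : ∀ s → PolynomiallyBounded (λ _ → s)
const-polynomial s = s , λ ℓ → n≤[2+m]^n ℓ s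

monomial-polynomial : ∀ k r → PolynomiallyBounded (λ ℓ → ℓ ^ k * r)
monomial-polynomial k r = k + r , λ ℓ → begin
  ℓ ^ k * r                  ≤⟨ *-mono-≤ (^-monoˡ-≤ k (m≤n+m ℓ 2)) (n≤[2+m]^n ℓ r) ⟩
  (2 + ℓ) ^ k * (2 + ℓ) ^ r  ≡⟨ ^-distribˡ-+-* (2 + ℓ) k r ⟨
  (2 + ℓ) ^ (k + r)          ∎
  where open ≤-Reasoning

+-polynomial : ∀ {f g} → PolynomiallyBounded f → PolynomiallyBounded g → PolynomiallyBounded (λ ℓ → f ℓ + g ℓ)
+-polynomial {f} {g} (c , f≤) (d , g≤) = suc (c + d) , λ ℓ → begin
  f ℓ + g ℓ                                  ≤⟨ +-mono-≤ (f≤ ℓ) (g≤ ℓ) ⟩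
  (2 + ℓ) ^ c + (2 + ℓ) ^ d                  ≤⟨ +-mono-≤ (^-monoʳ-≤ (2 + ℓ) (m≤m+n c d))
                                                          (^-monoʳ-≤ (2 + ℓ) (m≤n+m d c)) ⟩
  (2 + ℓ) ^ (c + d) + (2 + ℓ) ^ (c + d)      ≤⟨ +-monoʳ-≤ ((2 + ℓ) ^ (c + d)) (m≤m+n _ _) ⟩
  (2 + ℓ) ^ suc (c + d)                      ∎
  where open ≤-Reasoning

width-polynomial : ∀ {Γ} (ψ : LForm Γ) → PolynomiallyBounded (λ ℓ → width ℓ ψ)
width-polynomial (base s _ _)     = const-polynomial s
width-polynomial (exLog k _ r ψ)  = +-polynomial (width-polynomial ψ) (monomial-polynomial k r)
width-polynomial (allLog k _ r ψ) = +-polynomial (width-polynomial ψ) (monomial-polynomial k r)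
width-polynomial (andL ψ χ)       = +-polynomial (width-polynomial ψ) (width-polynomial χ)
width-polynomial (orL ψ χ)        = +-polynomial (width-polynomial ψ) (width-polynomial χ)

theorem4p4 : ¬ Σ Sentence (λ φ → (G : Graph) → (G ⊨ φ) ⇔ (2 ∣ n G))
theorem4p4 (φ , φ⇔even) with width-polynomial φ
... | c , width≤ with polynomial<exponential 4 c
... | t , small = 2∤1+2*n (2 ^ t) (Equivalence.to (φ⇔even odd) odd⊨φ)
  where
  odd even : Graph
  odd  = edgeless (2 ^ suc t)
  even = edgeless (1 + 2 ^ suc t)

  ℓ≡2+t : ⌈log₂ (n even) ⌉ ≡ 2 + t
  ℓ≡2+t = ⌈log₂[2+2^[1+n]]⌉≡2+n t

  budget : width ⌈log₂ (n even) ⌉ φ + 1 < n odd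
  budget = begin-strict
    width _ φ + 1                  ≡⟨ +-comm _ 1 ⟩
    1 + width _ φ                  ≤⟨ s≤s (width≤ _) ⟩
    1 + (2 + ⌈log₂ (n even) ⌉) ^ c ≡⟨ cong (λ ℓ → 1 + (2 + ℓ) ^ c) ℓ≡2+t ⟩
    1 + (4 + t) ^ c                <⟨ s≤s small ⟩
    1 + 2 ^ t                      ≤⟨ s≤s (m≤m+n (2 ^ t) _) ⟩
    1 + 2 ^ suc t                  ∎
    where open ≤-Reasoning

  even⊨φ : even ⊨ φ
  even⊨φ = Equivalence.from (φ⇔even even) (subst (2 ∣_) (sym (2+2^[1+n]≡2*[1+2^n] t)) (m∣m*n (1 + 2 ^ t)))

  odd⊨φ : odd ⊨ φ
  odd⊨φ = SatL-transfer (trans ℓ≡2+t (sym (⌈log₂[1+2^n]⌉≡1+n (suc t)))) φ zero↦zero (inj₁ (refl , refl))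
                        (m<n⇒m<1+n budget) budget (envRel λ ()) even⊨φ
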